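{- Let $(e_k)_{k\ge0}$ be a $q$-Catalan basis associated to the Catalan power series $P$. Then its predual basis $(\tilde e_i(z,t))_{i\in\mathbb N^2}$ is a basis of the vector space of power series in $(z,t)$: every power series $g(z,t)$ can be written uniquely as $g=\sum_{i\in\mathbb N^2}G_i\tilde e_i$.
   Context: $q$ is a fixed parameter; all series are formal. A Catalan power series is a power series $P(z,t)$ with $P(z,t)=t-z\tilde P(z,t)t^2$ for some power series $\tilde P$. A family $(e_k)_{k\ge0}$ of power series is a $q$-Catalan basis associated to $P$ if $e_k(qz)/e_k(z)=P(z,q^k)/P(z,1)$ for all $k\ge0$. The predual basis is $\tilde e_i(z,t)=z^{i_1}\prod_{0\le j<i_2}P(q^jz,t)$ for $i=(i_1,i_2)\in\mathbb N^2$, where an empty product equals $1$. -}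

module Defs where

open import Level using (_⊔_)
open import Algebra.Bundles using (CommutativeRing)
open import Data.Nat as ℕ using (ℕ; zero; suc; _∸_; _≤_)
open import Data.Product using (Σ; _×_; _,_; ∃)
open import Relation.Nullary using (¬_; does)
open import Data.Sum using (_⊎_)
open import Data.Bool using (if_then_else_; _∧_)

record Field (c ℓ : Level.Level) : Set (Level.suc (c ⊔ ℓ)) where
  field
    commRing : CommutativeRing c ℓ
  open CommutativeRing commRing public
  field
    1≉0     : ¬ (1# ≈ 0#)
    inverse : ∀ x → ¬ (x ≈ 0#) → Σ Carrier (λ y → x * y ≈ 1#)

module FPS {c ℓ} (K : Field c ℓ) where
  open Field K

  pow : Carrier → ℕ → Carrier
  pow x zero    = 1#
  pow x (suc n) = pow x n * x

  sumTo : ℕ → (ℕ → Carrier) → Carrier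
  sumTo zero    f = 0#
  sumTo (suc n) f = sumTo n f + f n

  Series1 : Set c
  Series1 = ℕ → Carrier

  _*₁_ : Series1 → Series1 → Series1
  (f *₁ g) n = sumTo (suc n) (λ i → f i * g (n ∸ i))

  dilate₁ : Carrier → Series1 → Series1
  dilate₁ x f n = pow x n * f n

  _≈₁_ : Series1 → Series1 → Set ℓ
  f ≈₁ g = ∀ n → f n ≈ g n

  -- Formal power series in (z,t): f a b = coefficient of z^a t^b.
  Series2 : Set c
  Series2 = ℕ → ℕ → Carrier

  _*₂_ : Series2 → Series2 → Series2
  (f *₂ g) a b = sumTo (suc a) (λ i → sumTo (suc b) (λ j → f i j * g (a ∸ i) (b ∸ j)))

  _≈₂_ : Series2 → Series2 → Set ℓ
  f ≈₂ g = ∀ a b → f a b ≈ g a b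

  one₂ : Series2
  one₂ zero zero = 1#
  one₂ _    _    = 0#

  mono : ℕ → ℕ → Series2
  mono m n a b = if does (a ℕ.≟ m) ∧ does (b ℕ.≟ n) then 1# else 0#

  dilateZ : Carrier → Series2 → Series2
  dilateZ x f a b = pow x a * f a b

  _·₂_ : Carrier → Series2 → Series2
  (x ·₂ f) a b = x * f a b

  -- Catalan power series P(z,t) = t - z P̃(z,t) t², given by P̃.
  catalan : Series2 → Series2
  catalan P̃ zero    (suc zero)    = 1#
  catalan P̃ zero    _             = 0#
  catalan P̃ (suc a) (suc (suc b)) = - P̃ a b
  catalan P̃ (suc a) _             = 0#

  prodP : Carrier → Series2 → ℕ → Series2
  prodP q P zero    = one₂
  prodP q P (suc k) = prodP q P k *₂ dilateZ (pow q k) P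

  predual : Carrier → Series2 → ℕ → ℕ → Series2
  predual q P i₁ i₂ = mono i₁ 0 *₂ prodP q P i₂

  -- Formal (coefficientwise, discrete-topology) summation of a family
  -- (f_i)_{i ∈ ℕ²} of series in (z,t): for each coefficient (a,b) only
  -- finitely many f_i contribute (all lie in some box [0,N)²), and the
  -- coefficient of g is the (finite) sum of those contributions.
  HasSum : (ℕ → ℕ → Series2) → Series2 → Set ℓ
  HasSum f g = ∀ a b → Σ ℕ (λ N →
      (∀ i₁ i₂ → (N ≤ i₁ ⊎ N ≤ i₂) → f i₁ i₂ a b ≈ 0#) ×
      (g a b ≈ sumTo N (λ i₁ → sumTo N (λ i₂ → f i₁ i₂ a b))))

  -- Specialising t to a scalar requires the z^n-coefficients of P̃
  -- to be polynomials in t; `bound n` bounds the t-degree of the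
  -- coefficient of z^n in P̃.
  record TPolynomial (P̃ : Series2) : Set ℓ where
    field
      bound  : ℕ → ℕ
      vanish : ∀ n m → bound n ≤ m → P̃ n m ≈ 0#

  evalCatalan : (P̃ : Series2) → TPolynomial P̃ → Carrier → Series1
  evalCatalan P̃ tp x zero    = x
  evalCatalan P̃ tp x (suc n) =
    - (pow x 2 * sumTo (TPolynomial.bound tp n) (λ m → P̃ n m * pow x m))

  -- (e_k) is a q-Catalan basis associated to P:
  --   e_k(qz)/e_k(z) = P(z,q^k)/P(z,1)   for all k,
  -- written cross-multiplied (P(z,1) is invertible, e_k is nonzero).
  IsQCatalanBasis : Carrier → (P̃ : Series2) → TPolynomial P̃ → (ℕ → Series1) → Set ℓ
  IsQCatalanBasis q P̃ tp e = ∀ k →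
    (Σ ℕ (λ n → ¬ (e k n ≈ 0#))) ×
    ((dilate₁ q (e k) *₁ evalCatalan P̃ tp 1#) ≈₁ (e k *₁ evalCatalan P̃ tp (pow q k)))

module Submission where

open import Defs
open import Level using (Level)
open import Data.Nat using (ℕ)
open import Data.Product using (Σ; _×_; _,_)

open import Data.Nat as ℕ using (zero; suc; _∸_; _<_; _≤_; s≤s)
import Data.Nat.Properties as ℕₚ
open import Data.Nat.Induction using (<-rec)
open import Data.Sum using (_⊎_; inj₁; inj₂)
open import Data.Empty using (⊥-elim)
open import Relation.Nullary using (yes; no)
open import Relation.Nullary.Decidable using (dec-true; dec-false)
open import Data.Bool using (true; false; if_then_else_; _∧_)
open import Relation.Binary.PropositionalEquality as ≡ using (_≡_; _≢_)
import Relation.Binary.Reasoning.Setoid as SetoidReasoning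
import Algebra.Properties.Group as GroupProperties

-- The predual family ẽ_(i₁,i₂) = z^{i₁} ∏_{j<i₂} P(q^j z, t) is unitriangular
-- with respect to the monomials z^a t^b: it only involves monomials with
-- a ≥ i₁ and b ≥ i₂, and its z^{i₁}-row is exactly t^{i₂}.  This is all that
-- is needed.
--
-- It then shows that the predual family is unitriangular: the z-free row of
-- the product ∏_{j<k} P(q^j z, t) is t^k and the product is divisible by t^k
-- (both because P ≡ t mod z and P ≡ 0 mod t, and these properties are
-- multiplicative), and multiplication by z^{i₁} shifts the rows by i₁.

module Basis {c ℓ} (K : Field c ℓ) where
  open Field K
  open FPS K
  open SetoidReasoning setoid
  open GroupProperties +-group using (∙-cancelˡ)

  factorˡ-zero : ∀ {x y} → x ≈ 0# → x * y ≈ 0#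
  factorˡ-zero x≈0 = trans (*-congʳ x≈0) (zeroˡ _)

  factorʳ-zero : ∀ {x y} → y ≈ 0# → x * y ≈ 0#
  factorʳ-zero y≈0 = trans (*-congˡ y≈0) (zeroʳ _)

  transfer : ∀ x y w → (x + - w) + (y + w) ≈ x + y
  transfer x y w = begin
    (x + - w) + (y + w)  ≈⟨ +-congˡ (+-comm y w) ⟩
    (x + - w) + (w + y)  ≈⟨ +-assoc x (- w) (w + y) ⟩
    x + (- w + (w + y))  ≈⟨ +-congˡ (+-assoc (- w) w y) ⟨
    x + ((- w + w) + y)  ≈⟨ +-congˡ (+-congʳ (-‿inverseˡ w)) ⟩
    x + (0# + y)         ≈⟨ +-congˡ (+-identityˡ y) ⟩
    x + y                ∎

  sumTo-cong : ∀ n {f g : ℕ → Carrier} → (∀ i → i < n → f i ≈ g i) → sumTo n f ≈ sumTo n g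
  sumTo-cong zero    f≈g = refl
  sumTo-cong (suc n) f≈g =
    +-cong (sumTo-cong n (λ i i<n → f≈g i (ℕₚ.m<n⇒m<1+n i<n))) (f≈g n ℕₚ.≤-refl)

  sumTo-zero : ∀ n {f : ℕ → Carrier} → (∀ i → i < n → f i ≈ 0#) → sumTo n f ≈ 0#
  sumTo-zero zero    f≈0 = refl
  sumTo-zero (suc n) f≈0 =
    trans (+-cong (sumTo-zero n (λ i i<n → f≈0 i (ℕₚ.m<n⇒m<1+n i<n))) (f≈0 n ℕₚ.≤-refl))
          (+-identityˡ 0#)

  sumTo-extend : ∀ m k {f : ℕ → Carrier} → (∀ i → m ≤ i → f i ≈ 0#) →
                 sumTo (k ℕ.+ m) f ≈ sumTo m f
  sumTo-extend m zero    f≈0 = refl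
  sumTo-extend m (suc k) f≈0 =
    trans (+-cong (sumTo-extend m k f≈0) (f≈0 (k ℕ.+ m) (ℕₚ.m≤n+m m k))) (+-identityʳ _)

  sumTo-support : ∀ {m n} {f : ℕ → Carrier} →
                  (∀ i → m ≤ i → f i ≈ 0#) → (∀ i → n ≤ i → f i ≈ 0#) →
                  sumTo m f ≈ sumTo n f
  sumTo-support {m} {n} {f} f≈0₁ f≈0₂ with ℕₚ.≤-total m n
  ... | inj₁ m≤n = sym (trans (reflexive (≡.cong (λ k → sumTo k f) (≡.sym (ℕₚ.m∸n+n≡m m≤n))))
                              (sumTo-extend m (n ∸ m) f≈0₁))
  ... | inj₂ n≤m = trans (reflexive (≡.cong (λ k → sumTo k f) (≡.sym (ℕₚ.m∸n+n≡m n≤m))))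
                         (sumTo-extend n (m ∸ n) f≈0₂)

  sumTo-single : ∀ n k {f : ℕ → Carrier} → k < n →
                 (∀ i → i < n → i ≢ k → f i ≈ 0#) → sumTo n f ≈ f k
  sumTo-single (suc n) k k<1+n others with k ℕ.≟ n
  ... | yes ≡.refl =
    trans (+-congʳ (sumTo-zero n (λ i i<n → others i (ℕₚ.m<n⇒m<1+n i<n) (ℕₚ.<⇒≢ i<n))))
          (+-identityˡ _)
  ... | no k≢n =
    trans (+-cong (sumTo-single n k (ℕₚ.≤∧≢⇒< (ℕₚ.≤-pred k<1+n) k≢n)
                                  (λ i i<n → others i (ℕₚ.m<n⇒m<1+n i<n)))
                  (others n ℕₚ.≤-refl (λ n≡k → k≢n (≡.sym n≡k))))
          (+-identityʳ _)

  record Unitriangular (E : ℕ → ℕ → Series2) : Set ℓ where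
    field
      below-z      : ∀ i₁ i₂ a b → a < i₁ → E i₁ i₂ a b ≈ 0#
      below-t      : ∀ i₁ i₂ a b → b < i₂ → E i₁ i₂ a b ≈ 0#
      diagonal     : ∀ a b → E a b a b ≈ 1#
      off-diagonal : ∀ a i₂ b → i₂ ≢ b → E a i₂ a b ≈ 0#

  module Triangular {E : ℕ → ℕ → Series2} (tri : Unitriangular E) where
    open Unitriangular tri

    Coefficients : Set c
    Coefficients = ℕ → ℕ → Carrier

    term-vanishes : ∀ (G : Coefficients) {i₁ i₂ a b} → (a < i₁ ⊎ b < i₂) →
                    G i₁ i₂ * E i₁ i₂ a b ≈ 0#
    term-vanishes G {i₁} {i₂} {a} {b} (inj₁ a<i₁) = factorʳ-zero (below-z i₁ i₂ a b a<i₁)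
    term-vanishes G {i₁} {i₂} {a} {b} (inj₂ b<i₂) = factorʳ-zero (below-t i₁ i₂ a b b<i₂)

    rowsBelow : Coefficients → ℕ → ℕ → ℕ → Carrier
    rowsBelow G n a b = sumTo n (λ i₁ → sumTo (suc b) (λ i₂ → G i₁ i₂ * E i₁ i₂ a b))

    rowsBelow-cong : ∀ {G G′} n a b → (∀ i₁ i₂ → i₁ < n → G i₁ i₂ ≈ G′ i₁ i₂) →
                     rowsBelow G n a b ≈ rowsBelow G′ n a b
    rowsBelow-cong n a b G≈G′ =
      sumTo-cong n (λ i₁ i₁<n → sumTo-cong (suc b) (λ i₂ _ → *-congʳ (G≈G′ i₁ i₂ i₁<n)))

    box-sum : ∀ G a b N → (∀ i₁ i₂ → (N ≤ i₁ ⊎ N ≤ i₂) → G i₁ i₂ * E i₁ i₂ a b ≈ 0#) →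
              sumTo N (λ i₁ → sumTo N (λ i₂ → G i₁ i₂ * E i₁ i₂ a b)) ≈ rowsBelow G a a b + G a b
    box-sum G a b N outside = begin
      sumTo N (λ i₁ → sumTo N (λ i₂ → G i₁ i₂ * E i₁ i₂ a b))
        ≈⟨ sumTo-cong N (λ i₁ _ → sumTo-support (λ i₂ N≤i₂ → outside i₁ i₂ (inj₂ N≤i₂))
                                                 (λ i₂ b<i₂ → term-vanishes G (inj₂ b<i₂))) ⟩
      rowsBelow G N a b
        ≈⟨ sumTo-support (λ i₁ N≤i₁ → sumTo-zero (suc b) (λ i₂ _ → outside i₁ i₂ (inj₁ N≤i₁)))
                         (λ i₁ a<i₁ → sumTo-zero (suc b) (λ i₂ _ → term-vanishes G (inj₁ a<i₁))) ⟩
      rowsBelow G a a b + sumTo (suc b) (λ i₂ → G a i₂ * E a i₂ a b)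
        ≈⟨ +-congˡ (sumTo-single (suc b) b ℕₚ.≤-refl
                      (λ i₂ _ i₂≢b → factorʳ-zero (off-diagonal a i₂ b i₂≢b))) ⟩
      rowsBelow G a a b + G a b * E a b a b
        ≈⟨ +-congˡ (trans (*-congˡ (diagonal a b)) (*-identityʳ _)) ⟩
      rowsBelow G a a b + G a b ∎

    triangular-system : ∀ {G g} → HasSum (λ i₁ i₂ → G i₁ i₂ ·₂ E i₁ i₂) g →
                        ∀ a b → g a b ≈ rowsBelow G a a b + G a b
    triangular-system {G} G-sums a b with G-sums a b
    ... | N , outside , g≈sum = trans g≈sum (box-sum G a b N outside)

    expansion-unique : ∀ {g} (G G′ : Coefficients) →
                       HasSum (λ i₁ i₂ → G i₁ i₂ ·₂ E i₁ i₂) g →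
                       HasSum (λ i₁ i₂ → G′ i₁ i₂ ·₂ E i₁ i₂) g →
                       ∀ i₁ i₂ → G i₁ i₂ ≈ G′ i₁ i₂
    expansion-unique G G′ G-sums G′-sums = <-rec (λ a → ∀ b → G a b ≈ G′ a b) row
      where
      row : ∀ a → (∀ {i₁} → i₁ < a → ∀ b → G i₁ b ≈ G′ i₁ b) → ∀ b → G a b ≈ G′ a b
      row a earlier b = ∙-cancelˡ (rowsBelow G a a b) (G a b) (G′ a b) (begin
        rowsBelow G a a b + G a b    ≈⟨ triangular-system G-sums a b ⟨
        _                            ≈⟨ triangular-system G′-sums a b ⟩
        rowsBelow G′ a a b + G′ a b  ≈⟨ +-congʳ (rowsBelow-cong a a b (λ i₁ i₂ i₁<a → earlier i₁<a i₂)) ⟨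
        rowsBelow G a a b + G′ a b   ∎)

    -- Existence: Gaussian elimination, removing from g one row of the
    -- expansion at a time.
    module Expansion (g : Series2) where
      -- what is left of g after eliminating the rows i₁ < n
      remainder : ℕ → Series2
      remainder zero    = g
      remainder (suc n) a b =
        remainder n a b + - sumTo (suc b) (λ i₂ → remainder n n i₂ * E n i₂ a b)

      coefficients : Coefficients
      coefficients i₁ i₂ = remainder i₁ i₁ i₂

      remainder-invariant : ∀ n a b → remainder n a b + rowsBelow coefficients n a b ≈ g a b
      remainder-invariant zero    a b = +-identityʳ (g a b)
      remainder-invariant (suc n) a b =
        trans (transfer (remainder n a b) (rowsBelow coefficients n a b) _)
              (remainder-invariant n a b)

      expansion : HasSum (λ i₁ i₂ → coefficients i₁ i₂ ·₂ E i₁ i₂) g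
      expansion a b = N , outside , (begin
        g a b                                                  ≈⟨ remainder-invariant a a b ⟨
        coefficients a b + rowsBelow coefficients a a b        ≈⟨ +-comm _ _ ⟩
        rowsBelow coefficients a a b + coefficients a b        ≈⟨ box-sum coefficients a b N outside ⟨
        sumTo N (λ i₁ → sumTo N (λ i₂ → coefficients i₁ i₂ * E i₁ i₂ a b)) ∎)
        where
        N : ℕ
        N = suc (a ℕ.+ b)
        outside : ∀ i₁ i₂ → (N ≤ i₁ ⊎ N ≤ i₂) → coefficients i₁ i₂ * E i₁ i₂ a b ≈ 0#
        outside i₁ i₂ (inj₁ N≤i₁) =
          term-vanishes coefficients (inj₁ (ℕₚ.<-≤-trans (s≤s (ℕₚ.m≤m+n a b)) N≤i₁))
        outside i₁ i₂ (inj₂ N≤i₂) =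
          term-vanishes coefficients (inj₂ (ℕₚ.<-≤-trans (s≤s (ℕₚ.m≤n+m b a)) N≤i₂))

  record LeadingTPower (k : ℕ) (F : Series2) : Set ℓ where
    field
      divisible : ∀ a b → b < k → F a b ≈ 0#
      leading   : F 0 k ≈ 1#
      others    : ∀ b → b ≢ k → F 0 b ≈ 0#

  one-leading : LeadingTPower 0 one₂
  one-leading = record { divisible = λ _ _ () ; leading = refl ; others = others }
    where
    others : ∀ b → b ≢ 0 → one₂ 0 b ≈ 0#
    others zero    b≢0 = ⊥-elim (b≢0 ≡.refl)
    others (suc b) _   = refl

  catalan-leading : ∀ x P̃ → LeadingTPower 1 (dilateZ x (catalan P̃))
  catalan-leading x P̃ = record { divisible = divisible ; leading = *-identityˡ 1# ; others = others }
    where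
    divisible : ∀ a b → b < 1 → dilateZ x (catalan P̃) a b ≈ 0#
    divisible zero    zero    _       = zeroʳ _
    divisible (suc a) zero    _       = zeroʳ _
    divisible _       (suc b) (s≤s ())
    others : ∀ b → b ≢ 1 → dilateZ x (catalan P̃) 0 b ≈ 0#
    others zero          _   = zeroʳ _
    others (suc zero)    b≢1 = ⊥-elim (b≢1 ≡.refl)
    others (suc (suc b)) _   = zeroʳ _

  ∸-below : ∀ {b j k l} → k ≤ j → j ≤ b → b < l ℕ.+ k → b ∸ j < l
  ∸-below {b} {j} {k} {l} k≤j j≤b b<l+k = ℕₚ.+-cancelʳ-< j (b ∸ j) l
    (≡.subst (ℕ._< l ℕ.+ j) (≡.sym (ℕₚ.m∸n+n≡m j≤b)) (ℕₚ.<-≤-trans b<l+k (ℕₚ.+-monoʳ-≤ l k≤j)))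

  zfree-row : ∀ F G b → (F *₂ G) 0 b ≈ sumTo (suc b) (λ j → F 0 j * G 0 (b ∸ j))
  zfree-row F G b = +-identityˡ _

  *-leading : ∀ {k l F G} → LeadingTPower k F → LeadingTPower l G →
              LeadingTPower (l ℕ.+ k) (F *₂ G)
  *-leading {k} {l} {F} {G} LF LG =
    record { divisible = divisible ; leading = leading ; others = others }
    where
    module LF = LeadingTPower LF
    module LG = LeadingTPower LG

    divisible : ∀ a b → b < l ℕ.+ k → (F *₂ G) a b ≈ 0#
    divisible a b b<l+k = sumTo-zero (suc a) (λ i _ → sumTo-zero (suc b) (λ j j<1+b → term i j j<1+b))
      where
      term : ∀ i j → j < suc b → F i j * G (a ∸ i) (b ∸ j) ≈ 0#
      term i j j<1+b with j ℕ.<? k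
      ... | yes j<k = factorˡ-zero (LF.divisible i j j<k)
      ... | no j≮k  = factorʳ-zero (LG.divisible (a ∸ i) (b ∸ j)
                                     (∸-below (ℕₚ.≮⇒≥ j≮k) (ℕₚ.≤-pred j<1+b) b<l+k))

    leading : (F *₂ G) 0 (l ℕ.+ k) ≈ 1#
    leading = begin
      (F *₂ G) 0 (l ℕ.+ k)
        ≈⟨ zfree-row F G (l ℕ.+ k) ⟩
      sumTo (suc (l ℕ.+ k)) (λ j → F 0 j * G 0 (l ℕ.+ k ∸ j))
        ≈⟨ sumTo-single (suc (l ℕ.+ k)) k (s≤s (ℕₚ.m≤n+m k l))
             (λ j _ j≢k → factorˡ-zero (LF.others j j≢k)) ⟩
      F 0 k * G 0 (l ℕ.+ k ∸ k)
        ≈⟨ *-cong LF.leading (trans (reflexive (≡.cong (G 0) (ℕₚ.m+n∸n≡m l k))) LG.leading) ⟩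
      1# * 1#
        ≈⟨ *-identityˡ 1# ⟩
      1# ∎

    others : ∀ b → b ≢ l ℕ.+ k → (F *₂ G) 0 b ≈ 0#
    others b b≢l+k = trans (zfree-row F G b) (sumTo-zero (suc b) term)
      where
      term : ∀ j → j < suc b → F 0 j * G 0 (b ∸ j) ≈ 0#
      term j j<1+b with j ℕ.≟ k
      ... | no j≢k     = factorˡ-zero (LF.others j j≢k)
      ... | yes ≡.refl = factorʳ-zero (LG.others (b ∸ j) λ b∸j≡l →
              b≢l+k (≡.trans (≡.sym (ℕₚ.m∸n+n≡m (ℕₚ.≤-pred j<1+b))) (≡.cong (ℕ._+ j) b∸j≡l)))

  prodP-leading : ∀ q P̃ k → LeadingTPower k (prodP q (catalan P̃) k)
  prodP-leading q P̃ zero    = one-leading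
  prodP-leading q P̃ (suc k) = *-leading (prodP-leading q P̃ k) (catalan-leading (pow q k) P̃)

  indicator-falseˡ : ∀ {x} y → x ≡ false → (if x ∧ y then 1# else 0#) ≡ 0#
  indicator-falseˡ y ≡.refl = ≡.refl

  indicator-falseʳ : ∀ x {y} → y ≡ false → (if x ∧ y then 1# else 0#) ≡ 0#
  indicator-falseʳ true  ≡.refl = ≡.refl
  indicator-falseʳ false ≡.refl = ≡.refl

  mono-off : ∀ m n a b → a ≢ m → mono m n a b ≡ 0#
  mono-off m n a b a≢m = indicator-falseˡ _ (dec-false (a ℕ.≟ m) a≢m)

  mono-off-t : ∀ m n a b → b ≢ n → mono m n a b ≡ 0#
  mono-off-t m n a b b≢n = indicator-falseʳ _ (dec-false (b ℕ.≟ n) b≢n)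

  mono-on : ∀ m n → mono m n m n ≡ 1#
  mono-on m n rewrite dec-true (m ℕ.≟ m) ≡.refl | dec-true (n ℕ.≟ n) ≡.refl = ≡.refl

  shift-below : ∀ m F a b → a < m → (mono m 0 *₂ F) a b ≈ 0#
  shift-below m F a b a<m = sumTo-zero (suc a) (λ i i<1+a → sumTo-zero (suc b) (λ j _ →
    factorˡ-zero (reflexive (mono-off m 0 i j (ℕₚ.<⇒≢ (ℕₚ.≤-<-trans (ℕₚ.≤-pred i<1+a) a<m))))))

  shift : ∀ m F a b → m ≤ a → (mono m 0 *₂ F) a b ≈ F (a ∸ m) b
  shift m F a b m≤a = begin
    (mono m 0 *₂ F) a b
      ≈⟨ sumTo-single (suc a) m (s≤s m≤a) (λ i _ i≢m → sumTo-zero (suc b) (λ j _ →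
           factorˡ-zero (reflexive (mono-off m 0 i j i≢m)))) ⟩
    sumTo (suc b) (λ j → mono m 0 m j * F (a ∸ m) (b ∸ j))
      ≈⟨ sumTo-single (suc b) 0 (s≤s ℕ.z≤n)
           (λ j _ j≢0 → factorˡ-zero (reflexive (mono-off-t m 0 m j j≢0))) ⟩
    mono m 0 m 0 * F (a ∸ m) b
      ≈⟨ *-congʳ (reflexive (mono-on m 0)) ⟩
    1# * F (a ∸ m) b
      ≈⟨ *-identityˡ _ ⟩
    F (a ∸ m) b ∎

  predual-unitriangular : ∀ q P̃ → Unitriangular (predual q (catalan P̃))
  predual-unitriangular q P̃ = record
    { below-z      = λ i₁ i₂ → shift-below i₁ (product i₂)
    ; below-t      = below-t
    ; diagonal     = λ a b → trans (diagonal-row a b b) (LeadingTPower.leading (prodP-leading q P̃ b))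
    ; off-diagonal = λ a i₂ b i₂≢b →
        trans (diagonal-row a i₂ b) (LeadingTPower.others (prodP-leading q P̃ i₂) b (≡.≢-sym i₂≢b))
    }
    where
    product : ℕ → Series2
    product = prodP q (catalan P̃)

    diagonal-row : ∀ a i₂ b → predual q (catalan P̃) a i₂ a b ≈ product i₂ 0 b
    diagonal-row a i₂ b = trans (shift a (product i₂) a b ℕₚ.≤-refl)
                                (reflexive (≡.cong (λ x → product i₂ x b) (ℕₚ.n∸n≡0 a)))

    below-t : ∀ i₁ i₂ a b → b < i₂ → predual q (catalan P̃) i₁ i₂ a b ≈ 0#
    below-t i₁ i₂ a b b<i₂ with a ℕ.<? i₁
    ... | yes a<i₁ = shift-below i₁ (product i₂) a b a<i₁
    ... | no a≮i₁  = trans (shift i₁ (product i₂) a b (ℕₚ.≮⇒≥ a≮i₁))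
                           (LeadingTPower.divisible (prodP-leading q P̃ i₂) (a ∸ i₁) b b<i₂)

lemma2p7 : ∀ {c ℓ : Level} (K : Field c ℓ) → let open FPS K in
    (q : Field.Carrier K) (P̃ : Series2) (tp : TPolynomial P̃) (e : ℕ → Series1) →
    IsQCatalanBasis q P̃ tp e →
    (g : Series2) →
      Σ (ℕ → ℕ → Field.Carrier K) (λ G → HasSum (λ i₁ i₂ → G i₁ i₂ ·₂ predual q (catalan P̃) i₁ i₂) g)
      × (∀ (G G′ : ℕ → ℕ → Field.Carrier K) →
           HasSum (λ i₁ i₂ → G i₁ i₂ ·₂ predual q (catalan P̃) i₁ i₂) g →
           HasSum (λ i₁ i₂ → G′ i₁ i₂ ·₂ predual q (catalan P̃) i₁ i₂) g →
           ∀ i₁ i₂ → Field._≈_ K (G i₁ i₂) (G′ i₁ i₂))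
lemma2p7 K q P̃ _ _ _ g = (coefficients , expansion) , expansion-unique
  where
  open Basis K
  open Triangular (predual-unitriangular q P̃)
  open Expansion g
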